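{- Let $Z=[-v_1,v_1]+\cdots+[-v_n,v_n]$ be a generic zonotope and let $\{Z\}_{(k)}$ be the $k$-dimensional skeleton of its standard cubical decomposition $\{Z\}$. Suppose $K$ is a $k$-dimensional cubical complex which is embeddable in, or mappable to, $\{Z\}_{(k)}$. Then $I(K)=0$.
   Context: A cubical complex is a regular CW-complex $K$ whose face poset $P_K$ is cubical: (a) for every $x\in P_K$ the lower interval $(P_K)_{\le x}$ is isomorphic to the face poset of a cube $I^q$, and (b) any pair $x,y\in P_K$ bounded from above has a least upper bound. The standard cubical decomposition $\{Z\}$ of the generic zonotope $Z$ is the cubical complex whose cells are parallelotopes of the form $\sum_{i\notin S}\epsilon_i v_i+\sum_{i\in S}[-v_i,v_i]$ with $S\subseteq\{1,\dots,n\}$ and $\epsilon_i\in\{ -1,1\}$; in particular its vertices are points $\epsilon_1v_1+\cdots+\epsilon_nv_n$ and its edges join vertices whose sign vectors differ in exactly one coordinate. A monotone map of posets $f:P\to Q$ is non-degenerate if for each $x\in P$ it restricts to an isomorphism $P_{\le x}\cong Q_{\le f(x)}$; a cell complex $K$ is mappable to $L$ if there is a non-degenerate map between their face posets. For a $k$-dimensional cubical complex $K$, the groupoid $\mathcal{C}(K)$ has as objects the $k$-cells of $K$; if two $k$-cells $\sigma_1,\sigma_2$ share a $(k-1)$-face $\delta$, an elementary morphism $\sigma_1\to\sigma_2$ is an isomorphism of their face posets fixing every face of $\delta$; morphisms are compositions of elementary morphisms. The holonomy group $\Pi(K,\sigma)=\mathrm{Hom}_{\mathcal{C}(K)}(\sigma,\sigma)$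 is a subgroup of $B_k$, the symmetry group of the $k$-cube; $B_k^{even}$ is the subgroup preserving the two-coloring of the bipartite vertex-edge graph of the $k$-cube. $I(K)=0$ if $\Pi(K,\sigma)\subset B_k^{even}$ for all $k$-cells $\sigma$, and $I(K)=1$ otherwise. -}

module Defs where

open import Data.Nat using (ℕ; zero; suc; _+_; _≤_)
open import Data.Bool using (Bool; true; false; not)
open import Data.Vec using (Vec; []; _∷_; lookup; replicate)
open import Data.Fin using (Fin)
open import Data.Product using (Σ; _×_; _,_; proj₁; ∃)
open import Data.Sum using (_⊎_)
open import Function using (id; _∘_)
open import Relation.Binary.PropositionalEquality using (_≡_)

record RawPoset : Set₁ where
  field
    Carrier : Set
    _≼_     : Carrier → Carrier → Set

record IsPoset (P : RawPoset) : Set where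
  open RawPoset P
  field
    ≼-refl    : ∀ {x} → x ≼ x
    ≼-trans   : ∀ {x y z} → x ≼ y → y ≼ z → x ≼ z
    ≼-antisym : ∀ {x y} → x ≼ y → y ≼ x → x ≡ y

-- f restricts to an isomorphism of lower intervals  P_{≤x} ≅ Q_{≤y}
-- (stated at the level of carriers).
record IsIntervalIso (P Q : RawPoset) (x : RawPoset.Carrier P)
       (y : RawPoset.Carrier Q)
       (f : RawPoset.Carrier P → RawPoset.Carrier Q) : Set where
  open RawPoset P renaming (_≼_ to _≼P_)
  open RawPoset Q renaming (_≼_ to _≼Q_)
  field
    inv      : RawPoset.Carrier Q → RawPoset.Carrier P
    f-into   : ∀ a → a ≼P x → f a ≼Q y
    inv-into : ∀ b → b ≼Q y → inv b ≼P x
    inv-f    : ∀ a → a ≼P x → inv (f a) ≡ a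
    f-inv    : ∀ b → b ≼Q y → f (inv b) ≡ b
    f-mono   : ∀ a a' → a ≼P x → a' ≼P x → a ≼P a' → f a ≼Q f a'
    f-refl   : ∀ a a' → a ≼P x → a' ≼P x → f a ≼Q f a' → a ≼P a'

-- Face poset of the cube I^q: sign vectors in {-,0,+}^q, where
-- coordinate nul means "free" ([-1,1]); the top cell is all-nul,
-- vertices are the vectors without nul.

data Sign : Set where
  neg nul pos : Sign

_⊑_ : ∀ {q} → Vec Sign q → Vec Sign q → Set
_⊑_ {q} x y = (i : Fin q) → (lookup y i ≡ nul) ⊎ (lookup x i ≡ lookup y i)

CubePoset : ℕ → RawPoset
CubePoset q = record { Carrier = Vec Sign q ; _≼_ = _⊑_ }

topCell : (q : ℕ) → Vec Sign q
topCell q = replicate q nul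

colour : ∀ {q} → Vec Sign q → Bool
colour []          = false
colour (neg ∷ xs)  = not (colour xs)
colour (nul ∷ xs)  = colour xs
colour (pos ∷ xs)  = colour xs

-- number of free coordinates (= dimension of the face)
nulls : ∀ {q} → Vec Sign q → ℕ
nulls []         = 0
nulls (nul ∷ xs) = suc (nulls xs)
nulls (neg ∷ xs) = nulls xs
nulls (pos ∷ xs) = nulls xs

record CubicalComplex : Set₁ where
  field
    poset   : RawPoset
  open RawPoset poset public
  field
    isPoset : IsPoset poset
    dim      : Carrier → ℕ
    chart    : (x : Carrier) → Carrier → Vec Sign (dim x)
    chart-iso : ∀ x → IsIntervalIso poset (CubePoset (dim x)) x
                        (topCell (dim x)) (chart x)
    lub : ∀ x y z → x ≼ z → y ≼ z →
          Σ Carrier λ u → (x ≼ u) × (y ≼ u) ×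
                          (∀ w → x ≼ w → y ≼ w → u ≼ w)

IsDim : CubicalComplex → ℕ → Set
IsDim K k = (∀ x → dim x ≤ k) × (Σ Carrier λ x → dim x ≡ k)
  where open CubicalComplex K

NonDegenerate : (P Q : RawPoset) → (RawPoset.Carrier P → RawPoset.Carrier Q) → Set
NonDegenerate P Q f =
  (∀ a b → a ≼P b → f a ≼Q f b) × (∀ x → IsIntervalIso P Q x (f x) f)
  where
  open RawPoset P renaming (_≼_ to _≼P_)
  open RawPoset Q renaming (_≼_ to _≼Q_)

Mappable : CubicalComplex → RawPoset → Set
Mappable K L = Σ (CubicalComplex.Carrier K → RawPoset.Carrier L)
                 (NonDegenerate (CubicalComplex.poset K) L)

Embeddable : CubicalComplex → RawPoset → Set
Embeddable K L = Σ (Carrier → RawPoset.Carrier L) λ f →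
    NonDegenerate poset L f
  × (∀ a b → f a ≡ f b → a ≡ b)
  × (∀ a b → RawPoset._≼_ L (f a) (f b) → a ≼ b)
  where open CubicalComplex K

-- Face poset of the k-skeleton {Z}_(k) of the standard cubical
-- decomposition of the generic zonotope Z = [-v_1,v_1]+...+[-v_n,v_n]:
-- the cell  Σ_{i∉S} ε_i v_i + Σ_{i∈S} [-v_i,v_i]  is encoded by the
-- sign vector with nul exactly on S and ε_i elsewhere; it lies in the
-- k-skeleton iff |S| ≤ k; inclusion of cells is _⊑_.

ZSkeleton : (n k : ℕ) → RawPoset
ZSkeleton n k = record
  { Carrier = Σ (Vec Sign n) (λ v → nulls v ≤ k)
  ; _≼_     = λ a b → proj₁ a ⊑ proj₁ b
  }

module _ (K : CubicalComplex) (k : ℕ) where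
  open CubicalComplex K

  record Elementary (σ τ : Carrier) (h : Carrier → Carrier) : Set where
    field
      δ     : Carrier
      δ-dim : suc (dim δ) ≡ k
      δ≼σ   : δ ≼ σ
      δ≼τ   : δ ≼ τ
      iso   : IsIntervalIso poset poset σ τ h
      fixes : ∀ d → d ≼ δ → h d ≡ d

  data Morphism (σ : Carrier) : Carrier → (Carrier → Carrier) → Set where
    idM  : Morphism σ σ id
    _▸_  : ∀ {τ ρ f h} → Morphism σ τ f → Elementary τ ρ h →
           Morphism σ ρ (h ∘ f)

  -- I(K) = 0 : every holonomy Π(K,σ) at a k-cell σ lies in B_k^even,
  -- i.e. preserves the two-colouring of the vertices of σ (read off
  -- through the cube chart of σ).
  IZero : Set
  IZero = ∀ σ → dim σ ≡ k → ∀ f → Morphism σ σ f →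
          ∀ u → u ≼ σ → dim u ≡ 0 →
          colour (chart σ u) ≡ colour (chart σ (f u))

{-# OPTIONS --safe #-}
-- A vertex of {Z} has a global colour, the parity of its minus signs.  An isomorphism
-- from the face poset of a cube onto a cell of {Z} sends edges to edges, so it either
-- preserves or reverses the colouring of all vertices of the cube at once.  Pulling the
-- global colouring back along the non-degenerate map, an elementary morphism fixes a
-- vertex of the common facet and hence preserves the global colour of every vertex; so
-- does every holonomy, which therefore preserves the colouring read off in the cube chart.
module Submission where

open import Defs
open import Data.Bool using (Bool; false; true; not; _xor_)
open import Data.Bool.Properties using (not-involutive; not-injective; xor-comm; xor-annihilates-not)
open import Data.Empty using (⊥-elim)
open import Data.Fin using (Fin; zero; suc)
open import Data.Nat using (ℕ; _≤_; z≤n)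
open import Data.Product using (∃; _×_; _,_; proj₁; proj₂)
open import Data.Sum using (_⊎_; inj₁; inj₂)
import Data.Sum as Sum
open import Data.Vec using (Vec; []; _∷_; lookup; updateAt; _[_]≔_)
open import Data.Vec.Properties using (lookup-replicate; lookup∘updateAt)
open import Data.Vec.Relation.Unary.All using (All; []; _∷_)
open import Data.Vec.Relation.Unary.All.Properties using (lookup⁺)
open import Function using (id; _∘_)
open import Relation.Binary.Definitions using (Transitive)
open import Relation.Binary.PropositionalEquality
  using (_≡_; _≢_; refl; sym; trans; cong; cong₂; subst; subst₂; module ≡-Reasoning)
open import Relation.Nullary using (¬_)

open ≡-Reasoning

private
  variable
    q : ℕ
    s t : Sign
    a b e x : Vec Sign q

xor-cancelˡ : ∀ z {x y} → z xor x ≡ z xor y → x ≡ y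
xor-cancelˡ false eq = eq
xor-cancelˡ true  eq = not-injective eq

xor-cancelʳ : ∀ z {x y} → x xor z ≡ y xor z → x ≡ y
xor-cancelʳ z {x} {y} eq = xor-cancelˡ z (trans (xor-comm z x) (trans eq (xor-comm y z)))

Minimal : (P : RawPoset) → RawPoset.Carrier P → Set
Minimal P u = ∀ v → RawPoset._≼_ P v u → v ≡ u

IsVertex : Vec Sign q → Set
IsVertex = All (_≢ nul)

opposite : Sign → Sign
opposite neg = pos
opposite nul = nul
opposite pos = neg

flipAt : Vec Sign q → Fin q → Vec Sign q
flipAt a i = updateAt a i opposite

edgeAt : Vec Sign q → Fin q → Vec Sign q
edgeAt a i = a [ i ]≔ nul

lowestVertex : Vec Sign q → Vec Sign q
lowestVertex []         = []
lowestVertex (nul ∷ a)  = neg ∷ lowestVertex a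
lowestVertex (neg ∷ a)  = neg ∷ lowestVertex a
lowestVertex (pos ∷ a)  = pos ∷ lowestVertex a

⊑-refl : a ⊑ a
⊑-refl i = inj₂ refl

⊑-trans : a ⊑ b → b ⊑ e → a ⊑ e
⊑-trans a⊑b b⊑e i with b⊑e i
... | inj₁ eᵢ≡nul = inj₁ eᵢ≡nul
... | inj₂ bᵢ≡eᵢ with a⊑b i
...   | inj₁ bᵢ≡nul = inj₁ (trans (sym bᵢ≡eᵢ) bᵢ≡nul)
...   | inj₂ aᵢ≡bᵢ  = inj₂ (trans aᵢ≡bᵢ bᵢ≡eᵢ)

⊑-top : ∀ (a : Vec Sign q) → a ⊑ topCell q
⊑-top a i = inj₁ (lookup-replicate i nul)

⊑-head : (s ∷ a) ⊑ (t ∷ b) → t ≡ nul ⊎ s ≡ t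
⊑-head le = le zero

⊑-tail : (s ∷ a) ⊑ (t ∷ b) → a ⊑ b
⊑-tail le = le ∘ suc

⊑-∷ : t ≡ nul ⊎ s ≡ t → a ⊑ b → (s ∷ a) ⊑ (t ∷ b)
⊑-∷ hd tl zero    = hd
⊑-∷ hd tl (suc i) = tl i

isVertex⇒minimal : IsVertex a → Minimal (CubePoset q) a
isVertex⇒minimal {a = []}    []          []      _   = refl
isVertex⇒minimal {a = s ∷ a} (s≢nul ∷ va) (t ∷ x) x⊑a with ⊑-head x⊑a
... | inj₁ s≡nul = ⊥-elim (s≢nul s≡nul)
... | inj₂ refl  = cong (t ∷_) (isVertex⇒minimal va x (⊑-tail x⊑a))

lowestVertex-⊑ : ∀ (a : Vec Sign q) → lowestVertex a ⊑ a
lowestVertex-⊑ []        ()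
lowestVertex-⊑ (nul ∷ a) = ⊑-∷ (inj₁ refl) (lowestVertex-⊑ a)
lowestVertex-⊑ (neg ∷ a) = ⊑-∷ (inj₂ refl) (lowestVertex-⊑ a)
lowestVertex-⊑ (pos ∷ a) = ⊑-∷ (inj₂ refl) (lowestVertex-⊑ a)

lowestVertex-isVertex : ∀ (a : Vec Sign q) → IsVertex (lowestVertex a)
lowestVertex-isVertex []        = []
lowestVertex-isVertex (nul ∷ a) = (λ ()) ∷ lowestVertex-isVertex a
lowestVertex-isVertex (neg ∷ a) = (λ ()) ∷ lowestVertex-isVertex a
lowestVertex-isVertex (pos ∷ a) = (λ ()) ∷ lowestVertex-isVertex a

minimal⇒isVertex : Minimal (CubePoset q) a → IsVertex a
minimal⇒isVertex {a = a} min =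
  subst IsVertex (min _ (lowestVertex-⊑ a)) (lowestVertex-isVertex a)

isVertex⇒nulls≡0 : IsVertex a → nulls a ≡ 0
isVertex⇒nulls≡0 {a = []}      []             = refl
isVertex⇒nulls≡0 {a = nul ∷ a} (nul≢nul ∷ _)  = ⊥-elim (nul≢nul refl)
isVertex⇒nulls≡0 {a = neg ∷ a} (_ ∷ va)       = isVertex⇒nulls≡0 va
isVertex⇒nulls≡0 {a = pos ∷ a} (_ ∷ va)       = isVertex⇒nulls≡0 va

vertexCell : ∀ {n} k (v : Vec Sign n) → IsVertex v → RawPoset.Carrier (ZSkeleton n k)
vertexCell k v vv = v , subst (_≤ k) (sym (isVertex⇒nulls≡0 vv)) z≤n

Z-minimal⇒isVertex : ∀ {n k} {c : RawPoset.Carrier (ZSkeleton n k)} →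
                     Minimal (ZSkeleton n k) c → IsVertex (proj₁ c)
Z-minimal⇒isVertex {n} {k} {c = a , _} min =
  subst IsVertex (cong proj₁ (min lowest (lowestVertex-⊑ a))) (lowestVertex-isVertex a)
  where
  lowest : RawPoset.Carrier (ZSkeleton n k)
  lowest = vertexCell k (lowestVertex a) (lowestVertex-isVertex a)

opposite-≢nul : s ≢ nul → opposite s ≢ nul
opposite-≢nul {neg} _     ()
opposite-≢nul {nul} s≢nul = s≢nul
opposite-≢nul {pos} _     ()

opposite-≢ : s ≢ nul → opposite s ≢ s
opposite-≢ {neg} _     ()
opposite-≢ {nul} s≢nul _ = s≢nul refl
opposite-≢ {pos} _     ()

sign-trichotomy : ∀ t → s ≢ nul → t ≡ nul ⊎ t ≡ s ⊎ t ≡ opposite s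
sign-trichotomy {neg} nul _     = inj₁ refl
sign-trichotomy {neg} neg _     = inj₂ (inj₁ refl)
sign-trichotomy {neg} pos _     = inj₂ (inj₂ refl)
sign-trichotomy {pos} nul _     = inj₁ refl
sign-trichotomy {pos} pos _     = inj₂ (inj₁ refl)
sign-trichotomy {pos} neg _     = inj₂ (inj₂ refl)
sign-trichotomy {nul} _   s≢nul = ⊥-elim (s≢nul refl)

flipAt-isVertex : IsVertex a → ∀ i → IsVertex (flipAt a i)
flipAt-isVertex (s≢nul ∷ va) zero    = opposite-≢nul s≢nul ∷ va
flipAt-isVertex (s≢nul ∷ va) (suc i) = s≢nul ∷ flipAt-isVertex va i

flipAt-≢ : IsVertex a → ∀ i → flipAt a i ≢ a
flipAt-≢ {a = a} va i eq =
  opposite-≢ (lookup⁺ va i) (trans (sym (lookup∘updateAt i a)) (cong (λ v → lookup v i) eq))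

colour-flipAt : IsVertex a → ∀ i → colour (flipAt a i) ≡ not (colour a)
colour-flipAt {a = nul ∷ a} (nul≢nul ∷ _) _       = ⊥-elim (nul≢nul refl)
colour-flipAt {a = neg ∷ a} _             zero    = sym (not-involutive (colour a))
colour-flipAt {a = pos ∷ a} _             zero    = refl
colour-flipAt {a = neg ∷ a} (_ ∷ va)      (suc i) = cong not (colour-flipAt va i)
colour-flipAt {a = pos ∷ a} (_ ∷ va)      (suc i) = colour-flipAt va i

⊑-edgeAt : ∀ (a : Vec Sign q) i → a ⊑ edgeAt a i
⊑-edgeAt (s ∷ a) zero    = ⊑-∷ (inj₁ refl) (⊑-refl {a = a})
⊑-edgeAt (s ∷ a) (suc i) = ⊑-∷ (inj₂ refl) (⊑-edgeAt a i)

edgeAt-⋢ : IsVertex a → ∀ i → ¬ (edgeAt a i ⊑ a)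
edgeAt-⋢ {a = a} va i e⊑a = lookup⁺ va i (begin
  lookup a i             ≡⟨ cong (λ v → lookup v i) (isVertex⇒minimal va (edgeAt a i) e⊑a) ⟨
  lookup (edgeAt a i) i  ≡⟨ lookup∘updateAt i a ⟩
  nul                    ∎)

edgeAt-faces : IsVertex a → ∀ i → x ⊑ edgeAt a i →
               x ≡ edgeAt a i ⊎ x ≡ a ⊎ x ≡ flipAt a i
edgeAt-faces {a = s ∷ a} {x = t ∷ x} (s≢nul ∷ va) zero x⊑e
  with isVertex⇒minimal va x (⊑-tail x⊑e)
... | refl = Sum.map (cong (_∷ a)) (Sum.map (cong (_∷ a)) (cong (_∷ a))) (sign-trichotomy t s≢nul)
edgeAt-faces {a = s ∷ a} {x = t ∷ x} (s≢nul ∷ va) (suc i) x⊑e with ⊑-head x⊑e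
... | inj₁ s≡nul = ⊥-elim (s≢nul s≡nul)
... | inj₂ refl  = Sum.map (cong (t ∷_)) (Sum.map (cong (t ∷_)) (cong (t ∷_)))
                           (edgeAt-faces va i (⊑-tail x⊑e))

free-coordinate : a ⊑ e → ¬ (e ⊑ a) → ∃ λ j → lookup e j ≡ nul
free-coordinate {a = []}    {e = []}    _   e⋢a = ⊥-elim (e⋢a (λ ()))
free-coordinate {a = s ∷ a} {e = t ∷ e} a⊑e e⋢a with ⊑-head a⊑e
... | inj₁ t≡nul = zero , t≡nul
... | inj₂ refl
  with free-coordinate {a = a} {e = e} (⊑-tail a⊑e) (e⋢a ∘ ⊑-∷ (inj₂ refl))
...   | j , eⱼ≡nul = suc j , eⱼ≡nul

updateAt-⊑ : ∀ j {f : Sign → Sign} → lookup e j ≡ nul → a ⊑ e → updateAt a j f ⊑ e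
updateAt-⊑ {e = t ∷ e} {a = s ∷ a} zero    eⱼ≡nul a⊑e = ⊑-∷ (inj₁ eⱼ≡nul) (⊑-tail a⊑e)
updateAt-⊑ {e = t ∷ e} {a = s ∷ a} (suc j) eⱼ≡nul a⊑e =
  ⊑-∷ (⊑-head a⊑e) (updateAt-⊑ {e = e} {a = a} j eⱼ≡nul (⊑-tail a⊑e))

flipInvariant-constant : ∀ {ℓ} {A : Set ℓ} (F : Vec Sign q → A) →
                         (∀ {a} → IsVertex a → ∀ i → F (flipAt a i) ≡ F a) →
                         IsVertex a → IsVertex b → F a ≡ F b
flipInvariant-constant F inv [] [] = refl
flipInvariant-constant {a = s ∷ a} {b = t ∷ b} F inv (s≢nul ∷ va) (t≢nul ∷ vb) = begin
  F (s ∷ a)    ≡⟨ toNeg s≢nul va ⟩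
  F (neg ∷ a)  ≡⟨ flipInvariant-constant (F ∘ (neg ∷_)) (λ vc i → inv ((λ ()) ∷ vc) (suc i))
                                         va vb ⟩
  F (neg ∷ b)  ≡⟨ toNeg t≢nul vb ⟨
  F (t ∷ b)    ∎
  where
  toNeg : ∀ {s c} → s ≢ nul → IsVertex c → F (s ∷ c) ≡ F (neg ∷ c)
  toNeg {neg} _     _  = refl
  toNeg {pos} _     vc = sym (inv ((λ ()) ∷ vc) zero)
  toNeg {nul} s≢nul _  = ⊥-elim (s≢nul refl)

intervalIso-refl : ∀ {P x} → IsIntervalIso P P x x id
intervalIso-refl = record
  { inv = id ; f-into = λ _ h → h ; inv-into = λ _ h → h
  ; inv-f = λ _ _ → refl ; f-inv = λ _ _ → refl
  ; f-mono = λ _ _ _ _ le → le ; f-refl = λ _ _ _ _ le → le }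

intervalIso-sym : ∀ {P Q x y f} (iso : IsIntervalIso P Q x y f) →
                  IsIntervalIso Q P y x (IsIntervalIso.inv iso)
intervalIso-sym {Q = Q} {f = f} iso = record
  { inv      = f
  ; f-into   = inv-into
  ; inv-into = f-into
  ; inv-f    = f-inv
  ; f-inv    = inv-f
  ; f-mono   = λ b b′ b≼y b′≼y b≼b′ →
                 f-refl (inv b) (inv b′) (inv-into b b≼y) (inv-into b′ b′≼y)
                 (subst₂ (RawPoset._≼_ Q) (sym (f-inv b b≼y)) (sym (f-inv b′ b′≼y)) b≼b′)
  ; f-refl   = λ b b′ b≼y b′≼y le → subst₂ (RawPoset._≼_ Q) (f-inv b b≼y) (f-inv b′ b′≼y)
                 (f-mono (inv b) (inv b′) (inv-into b b≼y) (inv-into b′ b′≼y) le)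
  }
  where open IsIntervalIso iso

intervalIso-trans : ∀ {P Q R x y z f g} → IsIntervalIso P Q x y f → IsIntervalIso Q R y z g →
                    IsIntervalIso P R x z (g ∘ f)
intervalIso-trans {f = f} {g} i j = record
  { inv      = I.inv ∘ J.inv
  ; f-into   = λ a a≼x → J.f-into (f a) (I.f-into a a≼x)
  ; inv-into = λ c c≼z → I.inv-into (J.inv c) (J.inv-into c c≼z)
  ; inv-f    = λ a a≼x → trans (cong I.inv (J.inv-f (f a) (I.f-into a a≼x))) (I.inv-f a a≼x)
  ; f-inv    = λ c c≼z → trans (cong g (I.f-inv (J.inv c) (J.inv-into c c≼z))) (J.f-inv c c≼z)
  ; f-mono   = λ a a′ a≼x a′≼x le → J.f-mono (f a) (f a′) (I.f-into a a≼x) (I.f-into a′ a′≼x)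
                 (I.f-mono a a′ a≼x a′≼x le)
  ; f-refl   = λ a a′ a≼x a′≼x le → I.f-refl a a′ a≼x a′≼x
                 (J.f-refl (f a) (f a′) (I.f-into a a≼x) (I.f-into a′ a′≼x) le)
  }
  where
  module I = IsIntervalIso i
  module J = IsIntervalIso j

intervalIso-minimal : ∀ {P Q x y f} → Transitive (RawPoset._≼_ Q) → IsIntervalIso P Q x y f →
                      ∀ {a} → RawPoset._≼_ P a x → Minimal P a → Minimal Q (f a)
intervalIso-minimal {P} {Q} {y = y} {f} ≼-trans iso {a} a≼x a-minimal b b≼fa = begin
  b          ≡⟨ f-inv b b≼y ⟨
  f (inv b)  ≡⟨ cong f (a-minimal (inv b) inv-b≼a) ⟩
  f a        ∎
  where
  open IsIntervalIso iso
  b≼y : RawPoset._≼_ Q b y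
  b≼y = ≼-trans b≼fa (f-into a a≼x)
  inv-b≼a : RawPoset._≼_ P (inv b) a
  inv-b≼a = f-refl (inv b) a (inv-into b b≼y) a≼x
              (subst (λ c → RawPoset._≼_ Q c (f a)) (sym (f-inv b b≼y)) b≼fa)

module VertexParity {q n k} {t : RawPoset.Carrier (ZSkeleton n k)}
  {ψ : Vec Sign q → RawPoset.Carrier (ZSkeleton n k)}
  (iso : IsIntervalIso (CubePoset q) (ZSkeleton n k) (topCell q) t ψ) where
  open IsIntervalIso iso

  P : Vec Sign q → Vec Sign n
  P = proj₁ ∘ ψ

  P-mono : ∀ {a b} → a ⊑ b → P a ⊑ P b
  P-mono {a} {b} = f-mono a b (⊑-top a) (⊑-top b)

  P-reflects : ∀ {a b} → P a ⊑ P b → a ⊑ b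
  P-reflects {a} {b} = f-refl a b (⊑-top a) (⊑-top b)

  -- The transitivity proof is η-expanded: its implicit cells cannot be inferred
  -- through the unfolded _⊑_.
  P-vertex : ∀ {a} → IsVertex a → IsVertex (P a)
  P-vertex {a} va = Z-minimal⇒isVertex
    (intervalIso-minimal (λ {c} {d} {e} → ⊑-trans {a = proj₁ c} {proj₁ d} {proj₁ e})
                         iso (⊑-top a) (isVertex⇒minimal va))

  P-onto-vertices : ∀ b → IsVertex b → b ⊑ proj₁ t → ∃ λ a → P a ≡ b
  P-onto-vertices b vb b⊑t = inv c , cong proj₁ (f-inv c b⊑t)
    where c = vertexCell k b vb

  -- The edge at a in direction i goes to a face above the vertex P a with some free
  -- coordinate j; the vertex across j from P a lies in that face, so it is the image of
  -- a face of the edge, and the only candidate is the other end flipAt a i.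
  P-flipAt : ∀ {a} → IsVertex a → ∀ i → ∃ λ j → P (flipAt a i) ≡ flipAt (P a) j
  P-flipAt {a} va i = j , image-is-flip (edgeAt-faces va i source⊑edge)
    where
    edge : Vec Sign q
    edge = edgeAt a i
    Pa⊑Pedge : P a ⊑ P edge
    Pa⊑Pedge = P-mono (⊑-edgeAt a i)
    free : ∃ λ j → lookup (P edge) j ≡ nul
    free = free-coordinate {a = P a} {e = P edge} Pa⊑Pedge (edgeAt-⋢ va i ∘ P-reflects)
    j : Fin n
    j = proj₁ free
    across : Vec Sign n
    across = flipAt (P a) j
    across-vertex : IsVertex across
    across-vertex = flipAt-isVertex (P-vertex va) j
    across⊑Pedge : across ⊑ P edge
    across⊑Pedge = updateAt-⊑ {e = P edge} {a = P a} j (proj₂ free) Pa⊑Pedge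
    preimage : ∃ λ x → P x ≡ across
    preimage = P-onto-vertices across across-vertex
                 (⊑-trans {a = across} {P edge} {proj₁ t} across⊑Pedge (f-into edge (⊑-top edge)))
    source : Vec Sign q
    source = proj₁ preimage
    P-source≡across : P source ≡ across
    P-source≡across = proj₂ preimage
    source⊑edge : source ⊑ edge
    source⊑edge = P-reflects {source} {edge} (subst (_⊑ P edge) (sym P-source≡across) across⊑Pedge)
    image-is-flip : source ≡ edge ⊎ source ≡ a ⊎ source ≡ flipAt a i → P (flipAt a i) ≡ across
    image-is-flip (inj₁ source≡edge) = ⊥-elim (lookup⁺ across-vertex j (begin
      lookup across j    ≡⟨ cong (λ v → lookup v j)
                                 (trans (sym P-source≡across) (cong P source≡edge)) ⟩
      lookup (P edge) j  ≡⟨ proj₂ free ⟩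
      nul                ∎))
    image-is-flip (inj₂ (inj₁ source≡a)) =
      ⊥-elim (flipAt-≢ (P-vertex va) j (trans (sym P-source≡across) (cong P source≡a)))
    image-is-flip (inj₂ (inj₂ source≡flip)) = trans (cong P (sym source≡flip)) P-source≡across

  parity : Vec Sign q → Bool
  parity a = colour (P a) xor colour a

  parity-flipAt : ∀ {a} → IsVertex a → ∀ i → parity (flipAt a i) ≡ parity a
  parity-flipAt {a} va i with P-flipAt va i
  ... | j , P-flip≡flip-P = begin
    colour (P (flipAt a i)) xor colour (flipAt a i)  ≡⟨ cong₂ _xor_ colour-P-flip (colour-flipAt va i) ⟩
    not (colour (P a)) xor not (colour a)           ≡⟨ xor-annihilates-not (colour (P a)) (colour a) ⟩
    parity a                                        ∎
    where
    colour-P-flip : colour (P (flipAt a i)) ≡ not (colour (P a))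
    colour-P-flip = trans (cong colour P-flip≡flip-P) (colour-flipAt (P-vertex va) j)

  parity-constant : ∀ {a b} → IsVertex a → IsVertex b → parity a ≡ parity b
  parity-constant = flipInvariant-constant parity parity-flipAt

Vec-length≡0-unique : ∀ {ℓ} {A : Set ℓ} {m} → m ≡ 0 → (v w : Vec A m) → v ≡ w
Vec-length≡0-unique refl [] [] = refl

module _ (K : CubicalComplex) where
  open CubicalComplex K
  open IsPoset isPoset

  dim≡0⇒minimal : ∀ {u} → dim u ≡ 0 → Minimal poset u
  dim≡0⇒minimal {u} dim≡0 v v≼u = begin
    v                ≡⟨ inv-f v v≼u ⟨
    inv (chart u v)  ≡⟨ cong inv (Vec-length≡0-unique dim≡0 (chart u v) (chart u u)) ⟩
    inv (chart u u)  ≡⟨ inv-f u ≼-refl ⟩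
    u                ∎
    where open IsIntervalIso (chart-iso u)

  chart-vertex : ∀ {σ u} → u ≼ σ → Minimal poset u → IsVertex (chart σ u)
  chart-vertex {σ} u≼σ u-minimal =
    minimal⇒isVertex (intervalIso-minimal (λ {a} {b} {c} → ⊑-trans {a = a} {b} {c})
                                          (chart-iso σ) u≼σ u-minimal)

  vertex-below : ∀ δ → ∃ λ w → w ≼ δ × Minimal poset w
  vertex-below δ = inv v , inv-into v (⊑-top v) ,
                   intervalIso-minimal ≼-trans (intervalIso-sym (chart-iso δ)) (⊑-top v)
                     (isVertex⇒minimal (lowestVertex-isVertex (topCell (dim δ))))
    where
    open IsIntervalIso (chart-iso δ)
    v : Vec Sign (dim δ)
    v = lowestVertex (topCell (dim δ))

  morphism-intervalIso : ∀ {d σ τ f} → Morphism K d σ τ f → IsIntervalIso poset poset σ τ f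
  morphism-intervalIso idM       = intervalIso-refl
  morphism-intervalIso (m ▸ el) = intervalIso-trans (morphism-intervalIso m) (Elementary.iso el)

  module _ {n k} {g : Carrier → RawPoset.Carrier (ZSkeleton n k)}
           (nd : NonDegenerate poset (ZSkeleton n k) g) where

    globalColour : Carrier → Bool
    globalColour u = colour (proj₁ (g u))

    colourOffset-constant : ∀ {σ τ h} → IsIntervalIso poset poset σ τ h →
                  ∀ {u v} → u ≼ σ → Minimal poset u → v ≼ σ → Minimal poset v →
                  globalColour (h u) xor colour (chart σ u) ≡ globalColour (h v) xor colour (chart σ v)
    colourOffset-constant {σ} {τ} {h} iso {u} {v} u≼σ u-minimal v≼σ v-minimal = begin
      globalColour (h u) xor colour (chart σ u)
        ≡⟨ cong (λ w → globalColour (h w) xor _) (inv-f u u≼σ) ⟨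
      parity (chart σ u)
        ≡⟨ parity-constant (chart-vertex u≼σ u-minimal) (chart-vertex v≼σ v-minimal) ⟩
      parity (chart σ v)
        ≡⟨ cong (λ w → globalColour (h w) xor _) (inv-f v v≼σ) ⟩
      globalColour (h v) xor colour (chart σ v)
        ∎
      where
      open IsIntervalIso (chart-iso σ) using (inv; inv-f)
      open VertexParity (intervalIso-trans (intervalIso-sym (chart-iso σ))
                                           (intervalIso-trans iso (proj₂ nd τ)))
        using (parity; parity-constant)

    elementary-preserves-globalColour : ∀ {d τ ρ h} → Elementary K d τ ρ h → ∀ {v} → v ≼ τ →
                                        Minimal poset v → globalColour (h v) ≡ globalColour v
    elementary-preserves-globalColour {τ = τ} {h = h} el {v} v≼τ v-minimal =
      xor-cancelʳ (colour (chart τ v)) (begin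
        globalColour (h v) xor colour (chart τ v)
          ≡⟨ colourOffset-constant iso v≼τ v-minimal w≼τ w-minimal ⟩
        globalColour (h w) xor colour (chart τ w)
          ≡⟨ cong (λ c → globalColour c xor colour (chart τ w)) (fixes w w≼δ) ⟩
        globalColour w xor colour (chart τ w)
          ≡⟨ colourOffset-constant intervalIso-refl w≼τ w-minimal v≼τ v-minimal ⟩
        globalColour v xor colour (chart τ v)
          ∎)
      where
      open Elementary el
      w : Carrier
      w = proj₁ (vertex-below δ)
      w≼δ : w ≼ δ
      w≼δ = proj₁ (proj₂ (vertex-below δ))
      w-minimal : Minimal poset w
      w-minimal = proj₂ (proj₂ (vertex-below δ))
      w≼τ : w ≼ τ
      w≼τ = ≼-trans w≼δ δ≼σ

    morphism-preserves-globalColour : ∀ {d σ τ f} → Morphism K d σ τ f → ∀ {u} → u ≼ σ →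
                                      Minimal poset u → globalColour (f u) ≡ globalColour u
    morphism-preserves-globalColour idM                 _   _         = refl
    morphism-preserves-globalColour (m ▸ el) u≼σ u-minimal =
      trans (elementary-preserves-globalColour el (f-into _ u≼σ)
                                               (intervalIso-minimal ≼-trans m-iso u≼σ u-minimal))
            (morphism-preserves-globalColour m u≼σ u-minimal)
      where
      m-iso = morphism-intervalIso m
      open IsIntervalIso m-iso using (f-into)

    nonDegenerate⇒IZero : ∀ d → IZero K d
    nonDegenerate⇒IZero d σ _ f m u u≼σ dim≡0 = xor-cancelˡ (globalColour u) (begin
      globalColour u xor colour (chart σ u)
        ≡⟨ colourOffset-constant intervalIso-refl u≼σ u-minimal fu≼σ fu-minimal ⟩
      globalColour (f u) xor colour (chart σ (f u))
        ≡⟨ cong (_xor colour (chart σ (f u))) (morphism-preserves-globalColour m u≼σ u-minimal) ⟩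
      globalColour u xor colour (chart σ (f u))
        ∎)
      where
      m-iso = morphism-intervalIso m
      open IsIntervalIso m-iso using (f-into)
      u-minimal : Minimal poset u
      u-minimal = dim≡0⇒minimal dim≡0
      fu≼σ : f u ≼ σ
      fu≼σ = f-into u u≼σ
      fu-minimal : Minimal poset (f u)
      fu-minimal = intervalIso-minimal ≼-trans m-iso u≼σ u-minimal

mainTheorem3 : (n k : ℕ) (K : CubicalComplex) → IsDim K k →
               (Embeddable K (ZSkeleton n k) ⊎ Mappable K (ZSkeleton n k)) →
               IZero K k
mainTheorem3 n k K _ (inj₁ (_ , nd , _)) = nonDegenerate⇒IZero K nd k
mainTheorem3 n k K _ (inj₂ (_ , nd))     = nonDegenerate⇒IZero K nd k
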